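{- Let $X=2\cdot[\mathbf{1}_3\,\mathbf{1}_2\mathbf{0}_1]=\begin{bmatrix}1&1&1&1\\1&1&1&1\\1&0&1&0\end{bmatrix}$. Then $\mathrm{ext}(m,X)=\mathrm{ext}(m,\mathbf{1}_4)$, and this set consists (up to row and column permutations) of the single matrix $[K_m^3\,K_m^2\,K_m^1\,K_m^0]$. Moreover, if $A\in\mathrm{Avoid}(m,X)$ and $\|A\|\ge\mathrm{forb}(m,\mathbf{1}_4)-1$, then $A\prec[K_m^3\,K_m^2\,K_m^1\,K_m^0]$.
   Context: A $(0,1)$-matrix is simple if it has no repeated columns; $\|A\|$ is its number of columns. $F\prec A$ means some submatrix of $A$ is a row and column permutation of $F$. $\mathrm{Avoid}(m,F)$ is the set of $m$-rowed simple $(0,1)$-matrices $A$ with $F\not\prec A$, $\mathrm{forb}(m,F)=\max\{\|A\|:A\in\mathrm{Avoid}(m,F)\}$, and $\mathrm{ext}(m,F)=\{A\in\mathrm{Avoid}(m,F):\|A\|=\mathrm{forb}(m,F)\}$. $\mathbf{1}_k$ is the $k\times1$ all-ones column, $\mathbf{1}_2\mathbf{0}_1$ is the column $(1,1,0)^T$, and $t\cdot F$ denotes $t$ copies of $F$ placed side by side. $K_m^\ell$ is the $m$-rowed matrix of all $\binom m\ell$ columns with exactly $\ell$ ones. -}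

module Defs where

open import Data.Nat using (ℕ; zero; suc; _≟_)
open import Data.Bool using (Bool; true; false)
open import Data.Fin using (Fin)
import Data.Fin as Fin
import Data.Bool
open import Data.Vec using (Vec; []; _∷_; lookup; replicate; count)
open import Data.List using (List; []; _∷_; _++_; map; filter; length)
import Data.List as L
open import Data.Product using (Σ; ∃; _×_; _,_)
open import Relation.Nullary using (¬_)
open import Relation.Binary.PropositionalEquality using (_≡_)
open import Function.Bundles using (_↔_; Inverse)
open import Function.Definitions using (Injective)
open import Data.Nat using (_≤_)

-- An m-rowed (0,1)-matrix with n columns, given by its columns.
-- Entry in row i, column j is  lookup (A j) i.
Mat : ℕ → ℕ → Set
Mat m n = Fin n → Vec Bool m

Simple : ∀ {m n} → Mat m n → Set
Simple A = Injective _≡_ _≡_ A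

_≺_ : ∀ {k l m n} → Mat k l → Mat m n → Set
_≺_ {k} {l} {m} {n} F A =
  Σ (Fin k → Fin m) λ ρ → Σ (Fin l → Fin n) λ σ →
    Injective _≡_ _≡_ ρ × Injective _≡_ _≡_ σ ×
    (∀ i j → lookup (A (σ j)) (ρ i) ≡ lookup (F j) i)

Avoid : ∀ {k l} (m : ℕ) → Mat k l → ∀ {n} → Mat m n → Set
Avoid m F A = Simple A × ¬ (F ≺ A)

IsForb : ∀ {k l} (m : ℕ) → Mat k l → ℕ → Set
IsForb m F f =
  Σ (Mat m f) (λ A → Avoid m F A) ×
  (∀ n (A : Mat m n) → Avoid m F A → n ≤ f)

Ext : ∀ {k l} (m : ℕ) → Mat k l → ∀ {n} → Mat m n → Set
Ext m F {n} A = Avoid m F A × (∀ n' (A' : Mat m n') → Avoid m F A' → n' ≤ n)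

_≅_ : ∀ {m n n'} → Mat m n → Mat m n' → Set
_≅_ {m} {n} {n'} A B =
  Σ (Fin m ↔ Fin m) λ ρ → Σ (Fin n ↔ Fin n') λ σ →
    ∀ i j → lookup (B (Inverse.to σ j)) (Inverse.to ρ i) ≡ lookup (A j) i

allVecs : (m : ℕ) → List (Vec Bool m)
allVecs zero = [] ∷ []
allVecs (suc m) = map (true ∷_) (allVecs m) L.++ map (false ∷_) (allVecs m)

weight : ∀ {m} → Vec Bool m → ℕ
weight v = count (λ b → b Data.Bool.≟ true) v

Kcols : (m ℓ : ℕ) → List (Vec Bool m)
Kcols m ℓ = filter (λ v → weight v ≟ ℓ) (allVecs m)

K3210cols : (m : ℕ) → List (Vec Bool m)
K3210cols m = Kcols m 3 ++ Kcols m 2 ++ Kcols m 1 ++ Kcols m 0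

K3210 : (m : ℕ) → Mat m (length (K3210cols m))
K3210 m = L.lookup (K3210cols m)

ones4 : Mat 4 1
ones4 _ = replicate 4 true

X : Mat 3 4
X Fin.zero = true ∷ true ∷ true ∷ []
X (Fin.suc Fin.zero) = true ∷ true ∷ false ∷ []
X (Fin.suc (Fin.suc Fin.zero)) = true ∷ true ∷ true ∷ []
X (Fin.suc (Fin.suc (Fin.suc Fin.zero))) = true ∷ true ∷ false ∷ []

{-# OPTIONS --safe #-}
module Submission where

-- Deleting a row r splits the column set p of a simple matrix into deleteRow r p, the columns
-- of the shorter matrix, and repeated r p, those occurring with both entries in row r; so
-- |p| = |repeated r p| + |deleteRow r p|.  Deleting a row preserves avoiding X and 2·1ₖ, while
-- the repeated part of an X-avoider avoids 2·1₂ and that of a 2·1ₖ₊₁-avoider avoids 2·1ₖ.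
-- Pascal's rule then bounds an X-avoider by the number of columns with at most three ones,
-- which is ‖[K_m^3 K_m^2 K_m^1 K_m^0]‖ = forb(m, 1₄).  If p has a column with four ones, the
-- same induction, deleting rows that keep such a column, gains 2; it bottoms out at the
-- all-ones column on four rows, settled by a case analysis.  Hence an X-avoider with at least
-- forb(m, 1₄) − 1 columns has no column with four ones, so it avoids 1₄ and embeds in K3210.
-- Conversely a simple matrix without such columns avoids X, since two distinct columns sharing
-- three ones give one of them a fourth one.

open import Defs
open import Data.Nat using (ℕ; zero; suc; _+_; _≟_; _≤_; _<_; _∸_; _<ᵇ_; _<?_; z≤n; s≤s)
open import Data.Nat.Properties
  using (≤-refl; ≤-reflexive; ≤-trans; <-irrefl; <⇒≱; ≮⇒≥; n≤1+n; m<n⇒m<1+n; m<1+n⇒m<n∨m≡n; m≤n+m∸n;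
         +-comm; +-assoc; +-mono-≤; +-monoˡ-≤; +-commutativeSemigroup; module ≤-Reasoning)
open import Algebra.Properties.CommutativeSemigroup +-commutativeSemigroup using (interchange; xy∙z≈xz∙y)
open import Data.Bool using (Bool; true; false; T; _∧_; _∨_; if_then_else_)
import Data.Bool as Bool
open import Data.Bool.Properties using (T-∧; T-∨)
open import Data.Fin using (Fin; zero; suc; punchIn; punchOut; join; splitAt; opposite)
open import Data.Fin.Patterns using (0F; 1F; 2F; 3F)
open import Data.Fin.Properties
  using (¬Fin0; 0≢1+n; suc-injective; punchIn-injective; punchInᵢ≢i; punchOut-injective; splitAt-join;
         injective⇒≤; any?; all?; ¬∀⟶∃¬; opposite-involutive)
open import Data.Vec using (Vec; []; _∷_; lookup; replicate; insertAt; removeAt)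
open import Data.Vec.Properties
  using (≡-dec; ∷-injectiveʳ; tabulate∘lookup; tabulate-cong; lookup-replicate; insertAt-lookup; insertAt-punchIn;
         insertAt-removeAt; removeAt-insertAt; removeAt-punchOut)
open import Data.Vec.Functional using () renaming (_∷_ to _∷ᶠ_; [] to []ᶠ)
open import Data.List using (List; []; _∷_; _++_; map; filter; length)
import Data.List as List
open import Data.List.Properties using (filter-++; length-++; ++-identityʳ)
open import Data.List.Membership.Propositional using (_∈_)
open import Data.List.Membership.Propositional.Properties
  using (∈-map⁺; ∈-map⁻; ∈-++⁺ˡ; ∈-++⁺ʳ; ∈-++⁻; ∈-filter⁺; ∈-filter⁻; ∈-lookup)
open import Data.List.Relation.Unary.Any using (here; index)
open import Data.List.Relation.Unary.Any.Properties using (lookup-index)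
import Data.List.Relation.Unary.All as All
open import Data.List.Relation.Unary.AllPairs using (_∷_)
open import Data.List.Relation.Unary.Unique.Propositional using (Unique)
import Data.List.Relation.Unary.Unique.Propositional.Properties as Unique
open import Data.Product using (Σ; ∃; ∃₂; _×_; _,_; proj₁; proj₂; map₂)
open import Data.Sum using (_⊎_; inj₁; inj₂; [_,_]′)
open import Data.Sum.Properties using (inj₁-injective; inj₂-injective)
open import Data.Empty using (⊥; ⊥-elim)
open import Function using (_∘_)
open import Function.Bundles using (_⇔_; mk⇔; Inverse; Injection; mk↔ₛ′; Equivalence)
open import Function.Definitions using (Injective)
open import Function.Properties.Inverse using (↔⇒↣)
open import Function.Construct.Identity using (↔-id)
open import Function.Construct.Symmetry using (↔-sym)
open import Relation.Nullary using (¬_; yes; no; does)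
open import Relation.Nullary.Decidable using (T?; ⌊_⌋; toWitness; fromWitness)
open import Relation.Unary using (Decidable)
open import Relation.Binary.PropositionalEquality

lookup-ext : ∀ {A : Set} {m} {u v : Vec A m} → (∀ i → lookup u i ≡ lookup v i) → u ≡ v
lookup-ext {u = u} {v} h = trans (sym (tabulate∘lookup u)) (trans (tabulate-cong h) (tabulate∘lookup v))

insertAt-injective : ∀ {A : Set} {m} (r : Fin (suc m)) {u v : Vec A m} {x y : A} →
                     insertAt u r x ≡ insertAt v r y → u ≡ v
insertAt-injective r {u} {v} {x} {y} e = begin
  u                            ≡⟨ removeAt-insertAt u r x ⟨
  removeAt (insertAt u r x) r  ≡⟨ cong (λ w → removeAt w r) e ⟩
  removeAt (insertAt v r y) r  ≡⟨ removeAt-insertAt v r y ⟩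
  v                            ∎
  where open ≡-Reasoning

insertAt-replicate : ∀ {A : Set} m (r : Fin (suc m)) (x : A) → insertAt (replicate m x) r x ≡ replicate (suc m) x
insertAt-replicate m       zero    x = refl
insertAt-replicate (suc m) (suc r) x = cong (x ∷_) (insertAt-replicate m r x)

replicate⊎∃false : ∀ {m} (u : Vec Bool m) → u ≡ replicate m true ⊎ ∃ λ r → lookup u r ≡ false
replicate⊎∃false []          = inj₁ refl
replicate⊎∃false (false ∷ u) = inj₂ (zero , refl)
replicate⊎∃false (true ∷ u)  with replicate⊎∃false u
... | inj₁ e        = inj₁ (cong (true ∷_) e)
... | inj₂ (r , e)  = inj₂ (suc r , e)

∷ᶠ-injective : ∀ {m k} {r : Fin m} {ρ : Fin k → Fin m} →
               (∀ i → ρ i ≢ r) → Injective _≡_ _≡_ ρ → Injective _≡_ _≡_ (r ∷ᶠ ρ)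
∷ᶠ-injective r∉ρ ρ-inj {zero}  {zero}  _ = refl
∷ᶠ-injective r∉ρ ρ-inj {zero}  {suc j} e = ⊥-elim (r∉ρ j (sym e))
∷ᶠ-injective r∉ρ ρ-inj {suc i} {zero}  e = ⊥-elim (r∉ρ i e)
∷ᶠ-injective r∉ρ ρ-inj {suc i} {suc j} e = cong suc (ρ-inj e)

weight-insertAt : ∀ {m} (u : Vec Bool m) r x → weight (insertAt u r x) ≡ weight (x ∷ u)
weight-insertAt u           zero    x     = refl
weight-insertAt (true ∷ u)  (suc r) true  = cong suc (weight-insertAt u r true)
weight-insertAt (true ∷ u)  (suc r) false = cong suc (weight-insertAt u r false)
weight-insertAt (false ∷ u) (suc r) x     = weight-insertAt u r x

weight-removeAt : ∀ {m} (u : Vec Bool (suc m)) r {x} → lookup u r ≡ x → weight u ≡ weight (x ∷ removeAt u r)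
weight-removeAt u r refl =
  trans (cong weight (sym (insertAt-removeAt u r))) (weight-insertAt (removeAt u r) r (lookup u r))

OnesAt : ∀ {m k} → Vec Bool m → (Fin k → Fin m) → Set
OnesAt v ρ = ∀ i → lookup v (ρ i) ≡ true

OnesAt⇒weight : ∀ {m k} (v : Vec Bool m) {ρ : Fin k → Fin m} →
                Injective _≡_ _≡_ ρ → OnesAt v ρ → k ≤ weight v
OnesAt⇒weight {k = zero} v _ _ = z≤n
OnesAt⇒weight {zero} {suc k} v {ρ} _ _ = ⊥-elim (¬Fin0 (ρ zero))
OnesAt⇒weight {suc m} {suc k} v {ρ} ρ-inj ones = begin
  suc k                         ≤⟨ s≤s (OnesAt⇒weight (removeAt v r) punched-inj punched-ones) ⟩
  weight (true ∷ removeAt v r)  ≡⟨ weight-removeAt v r (ones zero) ⟨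
  weight v                      ∎
  where
  open ≤-Reasoning
  r = ρ zero
  r≢ρ : ∀ i → r ≢ ρ (suc i)
  r≢ρ i e = 0≢1+n (ρ-inj e)
  punched : Fin k → Fin m
  punched i = punchOut (r≢ρ i)
  punched-inj : Injective _≡_ _≡_ punched
  punched-inj {i} {j} e = suc-injective (ρ-inj (punchOut-injective (r≢ρ i) (r≢ρ j) e))
  punched-ones : OnesAt (removeAt v r) punched
  punched-ones i = trans (removeAt-punchOut v (r≢ρ i)) (ones (suc i))

weight⇒OnesAt : ∀ {m k} (v : Vec Bool m) → k ≤ weight v →
                Σ (Fin k → Fin m) λ ρ → Injective _≡_ _≡_ ρ × OnesAt v ρ
weight⇒OnesAt {k = zero} v _ = (λ ()) , (λ { {()} }) , (λ ())
weight⇒OnesAt (false ∷ v) h with weight⇒OnesAt v h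
... | ρ , ρ-inj , ones = suc ∘ ρ , ρ-inj ∘ suc-injective , ones
weight⇒OnesAt {k = suc k} (true ∷ v) (s≤s h) with weight⇒OnesAt v h
... | ρ , ρ-inj , ones =
  zero ∷ᶠ (suc ∘ ρ) , ∷ᶠ-injective (λ i ()) (ρ-inj ∘ suc-injective) , λ { zero → refl ; (suc i) → ones i }

OnesAt-∌ : ∀ {m k} {ρ : Fin k → Fin m} {w : Vec Bool m} {d} →
           OnesAt w ρ → lookup w d ≡ false → ∀ i → ρ i ≢ d
OnesAt-∌ ones wᵈ i refl with trans (sym (ones i)) wᵈ
... | ()

OnesAt-∷ᶠ⇒weight : ∀ {m k} {ρ : Fin k → Fin m} {w : Vec Bool m} {d} →
                   Injective _≡_ _≡_ ρ → (∀ i → ρ i ≢ d) → OnesAt w ρ → lookup w d ≡ true → suc k ≤ weight w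
OnesAt-∷ᶠ⇒weight {w = w} ρ-inj d∉ρ ones wᵈ =
  OnesAt⇒weight w (∷ᶠ-injective d∉ρ ρ-inj) λ { zero → wᵈ ; (suc i) → ones i }

shared-ones⇒heavy : ∀ {m k} {ρ : Fin k → Fin m} {u v : Vec Bool m} → Injective _≡_ _≡_ ρ →
                    OnesAt u ρ → OnesAt v ρ → u ≢ v → suc k ≤ weight u ⊎ suc k ≤ weight v
shared-ones⇒heavy {m} {ρ = ρ} {u} {v} ρ-inj onesᵤ onesᵥ u≢v
  with ¬∀⟶∃¬ m _ (λ d → lookup u d Bool.≟ lookup v d) (u≢v ∘ lookup-ext)
... | d , differ with lookup u d in uᵈ | lookup v d in vᵈ
... | true  | true  = ⊥-elim (differ refl)
... | false | false = ⊥-elim (differ refl)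
... | true  | false = inj₁ (OnesAt-∷ᶠ⇒weight {ρ = ρ} {u} ρ-inj (OnesAt-∌ {w = v} onesᵥ vᵈ) onesᵤ uᵈ)
... | false | true  = inj₂ (OnesAt-∷ᶠ⇒weight {ρ = ρ} {v} ρ-inj (OnesAt-∌ {w = u} onesᵤ uᵈ) onesᵥ vᵈ)

-- Sets of columns

ColumnSet : ℕ → Set
ColumnSet m = Vec Bool m → Bool

size : ∀ {m} → ColumnSet m → ℕ
size {zero}  p = if p [] then 1 else 0
size {suc m} p = size (p ∘ (true ∷_)) + size (p ∘ (false ∷_))

size-mono : ∀ {m} {p q : ColumnSet m} → (∀ v → T (p v) → T (q v)) → size p ≤ size q
size-mono {zero} {p} {q} p⊆q with p [] | q [] | p⊆q []
... | false | _     | _ = z≤n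
... | true  | true  | _ = ≤-refl
... | true  | false | h = ⊥-elim (h _)
size-mono {suc m} p⊆q = +-mono-≤ (size-mono (p⊆q ∘ (true ∷_))) (size-mono (p⊆q ∘ (false ∷_)))

size-∅ : ∀ {m} → size {m} (λ _ → false) ≡ 0
size-∅ {zero}  = refl
size-∅ {suc m} = cong₂ _+_ (size-∅ {m}) (size-∅ {m})

_∧ᶜ_ _∨ᶜ_ : ∀ {m} → ColumnSet m → ColumnSet m → ColumnSet m
(p ∧ᶜ q) v = p v ∧ q v
(p ∨ᶜ q) v = p v ∨ q v

size-∧-∨ : ∀ {m} (p q : ColumnSet m) → size p + size q ≡ size (p ∧ᶜ q) + size (p ∨ᶜ q)
size-∧-∨ {zero} p q with p [] | q []
... | true  | true  = refl
... | true  | false = refl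
... | false | true  = refl
... | false | false = refl
size-∧-∨ {suc m} p q = begin
  (size p₁ + size p₀) + (size q₁ + size q₀)  ≡⟨ interchange (size p₁) _ _ _ ⟩
  (size p₁ + size q₁) + (size p₀ + size q₀)  ≡⟨ cong₂ _+_ (size-∧-∨ p₁ q₁) (size-∧-∨ p₀ q₀) ⟩
  (size (p₁ ∧ᶜ q₁) + size (p₁ ∨ᶜ q₁)) + (size (p₀ ∧ᶜ q₀) + size (p₀ ∨ᶜ q₀))
                                             ≡⟨ interchange (size (p₁ ∧ᶜ q₁)) _ _ _ ⟩
  size (p ∧ᶜ q) + size (p ∨ᶜ q)              ∎
  where
  open ≡-Reasoning
  p₁ p₀ q₁ q₀ : ColumnSet m
  p₁ = p ∘ (true ∷_)
  p₀ = p ∘ (false ∷_)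
  q₁ = q ∘ (true ∷_)
  q₀ = q ∘ (false ∷_)

withEntry : ∀ {m} → Fin (suc m) → Bool → ColumnSet (suc m) → ColumnSet m
withEntry r x p u = p (insertAt u r x)

size-withEntry : ∀ {m} r (p : ColumnSet (suc m)) → size p ≡ size (withEntry r true p) + size (withEntry r false p)
size-withEntry zero p = refl
size-withEntry {suc m} (suc r) p = begin
  size p₁ + size p₀
    ≡⟨ cong₂ _+_ (size-withEntry r p₁) (size-withEntry r p₀) ⟩
  (size (withEntry r true p₁) + size (withEntry r false p₁)) +
  (size (withEntry r true p₀) + size (withEntry r false p₀))
    ≡⟨ interchange (size (withEntry r true p₁)) _ _ _ ⟩
  size (withEntry (suc r) true p) + size (withEntry (suc r) false p)  ∎
  where
  open ≡-Reasoning
  p₁ p₀ : ColumnSet (suc m)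
  p₁ = p ∘ (true ∷_)
  p₀ = p ∘ (false ∷_)

deleteRow repeated : ∀ {m} → Fin (suc m) → ColumnSet (suc m) → ColumnSet m
deleteRow r p = withEntry r true p ∨ᶜ withEntry r false p
repeated  r p = withEntry r true p ∧ᶜ withEntry r false p

size-deleteRow : ∀ {m} r (p : ColumnSet (suc m)) → size p ≡ size (repeated r p) + size (deleteRow r p)
size-deleteRow r p = trans (size-withEntry r p) (size-∧-∨ (withEntry r true p) (withEntry r false p))

deleteRow⁺ : ∀ {m} r (p : ColumnSet (suc m)) {u} x → T (p (insertAt u r x)) → T (deleteRow r p u)
deleteRow⁺ r p true  h = Equivalence.from T-∨ (inj₁ h)
deleteRow⁺ r p false h = Equivalence.from T-∨ (inj₂ h)

deleteRow⁻ : ∀ {m} r (p : ColumnSet (suc m)) {u} → T (deleteRow r p u) → ∃ λ x → T (p (insertAt u r x))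
deleteRow⁻ r p h with Equivalence.to T-∨ h
... | inj₁ h₁ = true , h₁
... | inj₂ h₀ = false , h₀

deleteRow-removeAt : ∀ {m} r (p : ColumnSet (suc m)) {u} → T (p u) → T (deleteRow r p (removeAt u r))
deleteRow-removeAt r p {u} u∈p = deleteRow⁺ r p (lookup u r) (subst (T ∘ p) (sym (insertAt-removeAt u r)) u∈p)

repeated⁺ : ∀ {m} r (p : ColumnSet (suc m)) {u} → T (p (insertAt u r true)) → T (p (insertAt u r false)) →
            T (repeated r p u)
repeated⁺ r p h₁ h₀ = Equivalence.from T-∧ (h₁ , h₀)

repeated⁻ : ∀ {m} r (p : ColumnSet (suc m)) {u} → T (repeated r p u) → ∀ x → T (p (insertAt u r x))
repeated⁻ r p h true  = proj₁ (Equivalence.to T-∧ h)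
repeated⁻ r p h false = proj₂ (Equivalence.to T-∧ h)

-- Avoiding 2·1ₖ and X

Twice : ∀ {m} → ColumnSet m → (Vec Bool m → Set) → Set
Twice p P = ∃₂ λ u v → u ≢ v × (T (p u) × P u) × (T (p v) × P v)

Twice-deleteRow : ∀ {m} r (p : ColumnSet (suc m)) {P : Vec Bool m → Set} {Q : Vec Bool (suc m) → Set} →
                  (∀ {u} x → P u → Q (insertAt u r x)) → Twice (deleteRow r p) P → Twice p Q
Twice-deleteRow r p lift (u , v , u≢v , (u∈ , Pu) , (v∈ , Pv))
  with deleteRow⁻ r p u∈ | deleteRow⁻ r p v∈
... | x , u∈p | y , v∈p =
  insertAt u r x , insertAt v r y , u≢v ∘ insertAt-injective r , (u∈p , lift x Pu) , (v∈p , lift y Pv)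

Twice-repeated : ∀ {m} r (p : ColumnSet (suc m)) x {P : Vec Bool m → Set} {Q : Vec Bool (suc m) → Set} →
                 (∀ {u} → P u → Q (insertAt u r x)) → Twice (repeated r p) P → Twice p Q
Twice-repeated r p x lift (u , v , u≢v , (u∈ , Pu) , (v∈ , Pv)) =
  insertAt u r x , insertAt v r x , u≢v ∘ insertAt-injective r ,
  (repeated⁻ r p u∈ x , lift Pu) , (repeated⁻ r p v∈ x , lift Pv)

punchIn-∘-injective : ∀ {m k} (r : Fin (suc m)) {ρ : Fin k → Fin m} →
                      Injective _≡_ _≡_ ρ → Injective _≡_ _≡_ (punchIn r ∘ ρ)
punchIn-∘-injective r ρ-inj = ρ-inj ∘ punchIn-injective r _ _

withRow : ∀ {m k} → Fin (suc m) → (Fin k → Fin m) → Fin (suc k) → Fin (suc m)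
withRow r ρ = r ∷ᶠ (punchIn r ∘ ρ)

withRow-injective : ∀ {m k} (r : Fin (suc m)) {ρ : Fin k → Fin m} →
                    Injective _≡_ _≡_ ρ → Injective _≡_ _≡_ (withRow r ρ)
withRow-injective r {ρ} ρ-inj = ∷ᶠ-injective (λ i → punchInᵢ≢i r (ρ i)) (punchIn-∘-injective r ρ-inj)

OnesAt-insertAt : ∀ {m k} r x {u : Vec Bool m} {ρ : Fin k → Fin m} →
                  OnesAt u ρ → OnesAt (insertAt u r x) (punchIn r ∘ ρ)
OnesAt-insertAt r x {u} {ρ} ones i = trans (insertAt-punchIn u r x (ρ i)) (ones i)

Avoids-2·1 : ∀ {m} → ℕ → ColumnSet m → Set
Avoids-2·1 {m} k p = ∀ (ρ : Fin k → Fin m) → Injective _≡_ _≡_ ρ → ¬ Twice p (λ v → OnesAt v ρ)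

XColumn : ∀ {m} → Bool → (Fin 3 → Fin m) → Vec Bool m → Set
XColumn b ρ v = lookup v (ρ zero) ≡ b × OnesAt v (ρ ∘ suc)

-- ρ 0 is the row in which the two kinds of columns of X differ, i.e. the last row of X.
Avoids-X : ∀ {m} → ColumnSet m → Set
Avoids-X {m} p =
  ∀ (ρ : Fin 3 → Fin m) → Injective _≡_ _≡_ ρ → Twice p (XColumn true ρ) → ¬ Twice p (XColumn false ρ)

deleteRow-Avoids-2·1 : ∀ {m k} r {p : ColumnSet (suc m)} → Avoids-2·1 k p → Avoids-2·1 k (deleteRow r p)
deleteRow-Avoids-2·1 r {p} free ρ ρ-inj twice =
  free (punchIn r ∘ ρ) (punchIn-∘-injective r ρ-inj) (Twice-deleteRow r p (λ x → OnesAt-insertAt r x) twice)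

repeated-Avoids-2·1 : ∀ {m k} r {p : ColumnSet (suc m)} → Avoids-2·1 (suc k) p → Avoids-2·1 k (repeated r p)
repeated-Avoids-2·1 r {p} free ρ ρ-inj twice =
  free (withRow r ρ) (withRow-injective r ρ-inj) (Twice-repeated r p true lift twice)
  where
  lift : ∀ {u} → OnesAt u ρ → OnesAt (insertAt u r true) (withRow r ρ)
  lift {u} ones zero    = insertAt-lookup u r true
  lift     ones (suc i) = OnesAt-insertAt r true ones i

repeated-Avoids-2·1-zero : ∀ {m} r {p : ColumnSet (suc m)} → Avoids-2·1 0 p → ∀ u → ¬ T (repeated r p u)
repeated-Avoids-2·1-zero r {p} free u u∈ =
  free (λ ()) (λ { {()} })
    (insertAt u r true , insertAt u r false , differ , (repeated⁻ r p u∈ true , λ ()) , (repeated⁻ r p u∈ false , λ ()))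
  where
  differ : insertAt u r true ≢ insertAt u r false
  differ e with trans (sym (insertAt-lookup u r true)) (trans (cong (λ w → lookup w r) e) (insertAt-lookup u r false))
  ... | ()

deleteRow-Avoids-X : ∀ {m} r {p : ColumnSet (suc m)} → Avoids-X p → Avoids-X (deleteRow r p)
deleteRow-Avoids-X r {p} free ρ ρ-inj twice₁ twice₀ =
  free (punchIn r ∘ ρ) (punchIn-∘-injective r ρ-inj)
       (Twice-deleteRow r p lift twice₁) (Twice-deleteRow r p lift twice₀)
  where
  lift : ∀ {b u} x → XColumn b ρ u → XColumn b (punchIn r ∘ ρ) (insertAt u r x)
  lift {u = u} x (uᵈ , ones) = trans (insertAt-punchIn u r x (ρ zero)) uᵈ , OnesAt-insertAt r x ones

repeated-Avoids-X : ∀ {m} r {p : ColumnSet (suc m)} → Avoids-X p → Avoids-2·1 2 (repeated r p)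
repeated-Avoids-X r {p} free ρ ρ-inj twice =
  free (withRow r ρ) (withRow-injective r ρ-inj) (Twice-repeated r p true (lift true) twice)
       (Twice-repeated r p false (lift false) twice)
  where
  lift : ∀ x {u} → OnesAt u ρ → XColumn x (withRow r ρ) (insertAt u r x)
  lift x {u} ones = insertAt-lookup u r x , OnesAt-insertAt r x ones

-- On m rows, size (weightBelow k) = C(m, k − 1) + ⋯ + C(m, 0).
weightBelow : ∀ {m} → ℕ → ColumnSet m
weightBelow k v = weight v <ᵇ k

weightIs : ∀ {m} → ℕ → ColumnSet m
weightIs k v = does (weight v ≟ k)

size-Avoids-2·1 : ∀ k {m} (p : ColumnSet m) → Avoids-2·1 k p → size p ≤ size {m} (weightBelow (suc k))
size-Avoids-2·1 k {zero}  p free = size-mono {p = p} {weightBelow (suc k)} λ { [] _ → _ }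
size-Avoids-2·1 k {suc m} p free = begin
  size p                                                     ≡⟨ size-deleteRow zero p ⟩
  size (repeated zero p) + size (deleteRow zero p)
    ≤⟨ +-mono-≤ (size-repeated k free) (size-Avoids-2·1 k _ (deleteRow-Avoids-2·1 zero free)) ⟩
  size {m} (weightBelow k) + size {m} (weightBelow (suc k))  ∎
  where
  open ≤-Reasoning
  size-repeated : ∀ k → Avoids-2·1 k p → size (repeated zero p) ≤ size {m} (weightBelow k)
  size-repeated zero    free =
    size-mono {p = repeated zero p} λ u u∈ → ⊥-elim (repeated-Avoids-2·1-zero zero free u u∈)
  size-repeated (suc k) free = size-Avoids-2·1 k _ (repeated-Avoids-2·1 zero free)

size-Avoids-X : ∀ {m} (p : ColumnSet m) → Avoids-X p → size p ≤ size {m} (weightBelow 4)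
size-Avoids-X {zero}  p free = size-mono {p = p} {weightBelow 4} λ { [] _ → _ }
size-Avoids-X {suc m} p free = begin
  size p                                               ≡⟨ size-deleteRow zero p ⟩
  size (repeated zero p) + size (deleteRow zero p)
    ≤⟨ +-mono-≤ (size-Avoids-2·1 2 _ (repeated-Avoids-X zero free)) (size-Avoids-X _ (deleteRow-Avoids-X zero free)) ⟩
  size {m} (weightBelow 3) + size {m} (weightBelow 4)  ∎
  where open ≤-Reasoning

size-Avoids-2·1-111 : (p : ColumnSet 3) → Avoids-2·1 2 p → T (p (replicate 3 true)) →
                      size p + 2 ≤ size {3} (weightBelow 3)
size-Avoids-2·1-111 p free 111∈p =
  +-monoˡ-≤ 2 (size-mono {p = p} {q = weightBelow 2 ∨ᶜ weightIs 3} light-or-full)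
  where
  shares-two : ∀ {v} a b → a ≢ b → replicate 3 true ≢ v → T (p v) →
               lookup v a ≡ true → lookup v b ≡ true → ⊥
  shares-two {v} a b a≢b 111≢v v∈p vᵃ vᵇ =
    free rows (∷ᶠ-injective (λ { zero → a≢b ∘ sym ; (suc ()) }) (∷ᶠ-injective (λ ()) λ { {()} }))
      (replicate 3 true , v , 111≢v ,
       (111∈p , λ i → lookup-replicate (rows i) true) , (v∈p , λ { zero → vᵃ ; (suc zero) → vᵇ }))
    where
    rows : Fin 2 → Fin 3
    rows = a ∷ᶠ b ∷ᶠ []ᶠ
  light-or-full : ∀ v → T (p v) → T ((weightBelow 2 ∨ᶜ weightIs 3) v)
  light-or-full (false ∷ false ∷ false ∷ []) _ = _
  light-or-full (true  ∷ false ∷ false ∷ []) _ = _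
  light-or-full (false ∷ true  ∷ false ∷ []) _ = _
  light-or-full (false ∷ false ∷ true  ∷ []) _ = _
  light-or-full (true  ∷ true  ∷ true  ∷ []) _ = _
  light-or-full (true  ∷ true  ∷ false ∷ []) v∈p = ⊥-elim (shares-two 0F 1F (λ ()) (λ ()) v∈p refl refl)
  light-or-full (true  ∷ false ∷ true  ∷ []) v∈p = ⊥-elim (shares-two 0F 2F (λ ()) (λ ()) v∈p refl refl)
  light-or-full (false ∷ true  ∷ true  ∷ []) v∈p = ⊥-elim (shares-two 1F 2F (λ ()) (λ ()) v∈p refl refl)

-- Either 1111 lies in p together with a column of weight 3, and deleting the row of its zero
-- leaves 111 in the repeated part, or it does not, and the repeated part of row 0 is light.
Avoids-X-1111⇒small-repeated : (p : ColumnSet 4) → Avoids-X p → T (p (replicate 4 true)) →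
                               ∃ λ r → size (repeated r p) + 2 ≤ size {3} (weightBelow 3)
Avoids-X-1111⇒small-repeated p free 1111∈p with any? (λ r → T? (p (insertAt (replicate 3 true) r false)))
... | yes (r , flip∈p) =
  r , size-Avoids-2·1-111 (repeated r p) (repeated-Avoids-X r free)
        (repeated⁺ r p (subst (T ∘ p) (sym (insertAt-replicate 3 r true)) 1111∈p) flip∈p)
... | no no-flip = 0F , ≤-trans (+-monoˡ-≤ 2 (size-mono {p = repeated 0F p} {q = weightBelow 2} light)) (n≤1+n 6)
  where
  light : ∀ w → T (repeated 0F p w) → T (weightBelow 2 w)
  light (false ∷ false ∷ false ∷ []) _ = _
  light (true  ∷ false ∷ false ∷ []) _ = _
  light (false ∷ true  ∷ false ∷ []) _ = _
  light (false ∷ false ∷ true  ∷ []) _ = _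
  light (true  ∷ true  ∷ true  ∷ []) w∈ = ⊥-elim (no-flip (0F , repeated⁻ 0F p w∈ false))
  light (false ∷ true  ∷ true  ∷ []) w∈ = ⊥-elim (no-flip (1F , repeated⁻ 0F p w∈ true))
  light (true  ∷ false ∷ true  ∷ []) w∈ = ⊥-elim (no-flip (2F , repeated⁻ 0F p w∈ true))
  light (true  ∷ true  ∷ false ∷ []) w∈ = ⊥-elim (no-flip (3F , repeated⁻ 0F p w∈ true))

size-Avoids-X-1111 : (p : ColumnSet 4) → Avoids-X p → T (p (replicate 4 true)) → size p + 2 ≤ size {4} (weightBelow 4)
size-Avoids-X-1111 p free 1111∈p with Avoids-X-1111⇒small-repeated p free 1111∈p
... | r , small = begin
  size p + 2                                           ≡⟨ cong (_+ 2) (size-deleteRow r p) ⟩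
  size (repeated r p) + size (deleteRow r p) + 2       ≡⟨ xy∙z≈xz∙y (size (repeated r p)) _ 2 ⟩
  size (repeated r p) + 2 + size (deleteRow r p)       ≤⟨ +-mono-≤ small (size-Avoids-X _ (deleteRow-Avoids-X r free)) ⟩
  size {3} (weightBelow 3) + size {3} (weightBelow 4)  ∎
  where open ≤-Reasoning

HeavyStable : ℕ → Set
HeavyStable m = ∀ (p : ColumnSet m) {u} → Avoids-X p → T (p u) → 4 ≤ weight u → size p + 2 ≤ size {m} (weightBelow 4)

HeavyStable-deleteRow : ∀ {m} → HeavyStable m → ∀ r {p : ColumnSet (suc m)} {u} → Avoids-X p → T (p u) →
                        4 ≤ weight (removeAt u r) → size p + 2 ≤ size {suc m} (weightBelow 4)
HeavyStable-deleteRow {m} stable r {p} free u∈p heavy = begin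
  size p + 2                                           ≡⟨ cong (_+ 2) (size-deleteRow r p) ⟩
  size (repeated r p) + size (deleteRow r p) + 2       ≡⟨ +-assoc (size (repeated r p)) _ 2 ⟩
  size (repeated r p) + (size (deleteRow r p) + 2)
    ≤⟨ +-mono-≤ (size-Avoids-2·1 2 _ (repeated-Avoids-X r free))
                (stable _ (deleteRow-Avoids-X r free) (deleteRow-removeAt r p u∈p) heavy) ⟩
  size {m} (weightBelow 3) + size {m} (weightBelow 4)  ∎
  where open ≤-Reasoning

HeavyStable-replicate : ∀ {m} → HeavyStable m → (p : ColumnSet (suc m)) → Avoids-X p →
                        T (p (replicate (suc m) true)) → 4 ≤ weight (replicate (suc m) true) →
                        size p + 2 ≤ size {suc m} (weightBelow 4)
HeavyStable-replicate {0} _ _ _ _ (s≤s ())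
HeavyStable-replicate {1} _ _ _ _ (s≤s (s≤s ()))
HeavyStable-replicate {2} _ _ _ _ (s≤s (s≤s (s≤s ())))
HeavyStable-replicate {3} _ p free full _ = size-Avoids-X-1111 p free full
HeavyStable-replicate {suc (suc (suc (suc m)))} stable p free full _ =
  HeavyStable-deleteRow stable 0F free full (s≤s (s≤s (s≤s (s≤s z≤n))))

size-Avoids-X-heavy : ∀ m → HeavyStable m
size-Avoids-X-heavy zero    p {[]} _ _ ()
size-Avoids-X-heavy (suc m) p {u} free u∈p heavy with replicate⊎∃false u
... | inj₁ refl     = HeavyStable-replicate (size-Avoids-X-heavy m) p free u∈p heavy
... | inj₂ (r , uʳ) =
  HeavyStable-deleteRow (size-Avoids-X-heavy m) r free u∈p (≤-trans heavy (≤-reflexive (weight-removeAt u r uʳ)))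

columnsOf : ∀ {m n} → Mat m n → ColumnSet m
columnsOf A v = ⌊ any? (λ j → ≡-dec Bool._≟_ (A j) v) ⌋

columnsOf-column : ∀ {m n} (A : Mat m n) j → T (columnsOf A (A j))
columnsOf-column A j = fromWitness (j , refl)

columnsOf⁻ : ∀ {m n} (A : Mat m n) {v} → T (columnsOf A v) → ∃ λ j → A j ≡ v
columnsOf⁻ A = toWitness

rank : ∀ {m} (p : ColumnSet m) v → T (p v) → Fin (size p)
rank {zero} p [] v∈p with p []
rank {zero} p [] _  | true = zero
rank {suc m} p (true  ∷ v) v∈p = join _ _ (inj₁ (rank (p ∘ (true ∷_)) v v∈p))
rank {suc m} p (false ∷ v) v∈p = join _ _ (inj₂ (rank (p ∘ (false ∷_)) v v∈p))

join-injective : ∀ m n {x y : Fin m ⊎ Fin n} → join m n x ≡ join m n y → x ≡ y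
join-injective m n {x} {y} e = trans (sym (splitAt-join m n x)) (trans (cong (splitAt m) e) (splitAt-join m n y))

rank-injective : ∀ {m} (p : ColumnSet m) {v w} (v∈p : T (p v)) (w∈p : T (p w)) →
                 rank p v v∈p ≡ rank p w w∈p → v ≡ w
rank-injective {zero} p {[]} {[]} _ _ _ = refl
rank-injective {suc m} p {true ∷ v} {true ∷ w} v∈p w∈p e =
  cong (true ∷_) (rank-injective _ v∈p w∈p (inj₁-injective (join-injective _ _ e)))
rank-injective {suc m} p {false ∷ v} {false ∷ w} v∈p w∈p e =
  cong (false ∷_) (rank-injective _ v∈p w∈p (inj₂-injective (join-injective _ _ e)))
rank-injective {suc m} p {true ∷ v} {false ∷ w} v∈p w∈p e
  with join-injective _ _ {inj₁ (rank _ v v∈p)} {inj₂ (rank _ w w∈p)} e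
... | ()
rank-injective {suc m} p {false ∷ v} {true ∷ w} v∈p w∈p e
  with join-injective _ _ {inj₂ (rank _ v v∈p)} {inj₁ (rank _ w w∈p)} e
... | ()

size-columnsOf : ∀ {m n} {A : Mat m n} → Simple A → n ≤ size (columnsOf A)
size-columnsOf {A = A} simple =
  injective⇒≤ {f = λ j → rank (columnsOf A) (A j) (columnsOf-column A j)} (simple ∘ rank-injective _ _ _)

Twice-columnsOf : ∀ {m n} (A : Mat m n) {P : Vec Bool m → Set} → Twice (columnsOf A) P →
                  ∃₂ λ j k → j ≢ k × P (A j) × P (A k)
Twice-columnsOf A (u , v , u≢v , (u∈ , Pu) , (v∈ , Pv)) with columnsOf⁻ A u∈ | columnsOf⁻ A v∈
... | j , refl | k , refl = j , k , u≢v ∘ cong A , Pu , Pv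

XColumn⇒X : ∀ {m} {ρ : Fin 3 → Fin m} {b v} → XColumn b ρ v →
            ∀ i → lookup v (ρ (opposite i)) ≡ lookup (true ∷ true ∷ b ∷ []) i
XColumn⇒X (vᵈ , ones) 0F = ones 1F
XColumn⇒X (vᵈ , ones) 1F = ones 0F
XColumn⇒X (vᵈ , ones) 2F = vᵈ

opposite-injective : ∀ {n} → Injective _≡_ _≡_ (opposite {n})
opposite-injective {_} {i} {j} e = trans (sym (opposite-involutive i)) (trans (cong opposite e) (opposite-involutive j))

Avoids-X-columnsOf : ∀ {m n} {A : Mat m n} → ¬ (X ≺ A) → Avoids-X (columnsOf A)
Avoids-X-columnsOf {A = A} noX ρ ρ-inj twice₁ twice₀
  with Twice-columnsOf A twice₁ | Twice-columnsOf A twice₀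
... | j₁ , j₂ , j₁≢j₂ , col₁ , col₂ | k₁ , k₂ , k₁≢k₂ , col₃ , col₄ =
  noX (ρ ∘ opposite , σ , opposite-injective ∘ ρ-inj , σ-inj , embeds)
  where
  σ : Fin 4 → Fin _
  σ = j₁ ∷ᶠ k₁ ∷ᶠ j₂ ∷ᶠ k₂ ∷ᶠ []ᶠ
  differ : ∀ {j k} → XColumn true ρ (A j) → XColumn false ρ (A k) → j ≢ k
  differ (ones , _) (zeros , _) refl with trans (sym ones) zeros
  ... | ()
  σ-inj : Injective _≡_ _≡_ σ
  σ-inj = ∷ᶠ-injective
           (λ { 0F → differ col₁ col₃ ∘ sym ; 1F → j₁≢j₂ ∘ sym ; 2F → differ col₁ col₄ ∘ sym ; (suc (suc (suc ()))) })
         (∷ᶠ-injective (λ { 0F → differ col₂ col₃ ; 1F → k₁≢k₂ ∘ sym ; (suc (suc ())) })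
         (∷ᶠ-injective (λ { 0F → differ col₂ col₄ ∘ sym ; (suc ()) })
         (∷ᶠ-injective (λ ()) λ { {()} })))
  embeds : ∀ i c → lookup (A (σ c)) (ρ (opposite i)) ≡ lookup (X c) i
  embeds i 0F = XColumn⇒X {ρ = ρ} {v = A j₁} col₁ i
  embeds i 1F = XColumn⇒X {ρ = ρ} {v = A k₁} col₃ i
  embeds i 2F = XColumn⇒X {ρ = ρ} {v = A j₂} col₂ i
  embeds i 3F = XColumn⇒X {ρ = ρ} {v = A k₂} col₄ i

Light : ∀ {m n} → Mat m n → Set
Light A = ∀ j → weight (A j) < 4

Light⊎heavy : ∀ {m n} (A : Mat m n) → Light A ⊎ ∃ λ j → 4 ≤ weight (A j)
Light⊎heavy {n = n} A with all? (λ j → weight (A j) <? 4)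
... | yes light = inj₁ light
... | no ¬light = inj₂ (map₂ ≮⇒≥ (¬∀⟶∃¬ n _ (λ j → weight (A j) <? 4) ¬light))

Light⇒¬X≺ : ∀ {m n} {A : Mat m n} → Light A → Simple A → ¬ (X ≺ A)
Light⇒¬X≺ {A = A} light simple (ρ , σ , ρ-inj , σ-inj , embeds) =
  [ <⇒≱ (light (σ 0F)) , <⇒≱ (light (σ 2F)) ]′
    (shared-ones⇒heavy ρ-inj ones₀ ones₂ (λ e → 0≢2 (σ-inj (simple e))))
  where
  ones₀ : OnesAt (A (σ 0F)) ρ
  ones₀ i = trans (embeds i 0F) (lookup-replicate i true)
  ones₂ : OnesAt (A (σ 2F)) ρ
  ones₂ i = trans (embeds i 2F) (lookup-replicate i true)
  0≢2 : 0F ≢ 2F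
  0≢2 ()

ones4≺⇒heavy : ∀ {m n} {A : Mat m n} → ones4 ≺ A → ∃ λ j → 4 ≤ weight (A j)
ones4≺⇒heavy {A = A} (ρ , σ , ρ-inj , _ , embeds) =
  σ 0F , OnesAt⇒weight (A (σ 0F)) ρ-inj (λ i → trans (embeds i 0F) (lookup-replicate i true))

heavy⇒ones4≺ : ∀ {m n} {A : Mat m n} j → 4 ≤ weight (A j) → ones4 ≺ A
heavy⇒ones4≺ {A = A} j heavy with weight⇒OnesAt (A j) heavy
... | ρ , ρ-inj , ones =
  ρ , (λ _ → j) , ρ-inj , (λ { {0F} {0F} _ → refl }) , λ i _ → trans (ones i) (sym (lookup-replicate i true))

Light⇒¬ones4≺ : ∀ {m n} {A : Mat m n} → Light A → ¬ (ones4 ≺ A)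
Light⇒¬ones4≺ {A = A} light o with ones4≺⇒heavy {A = A} o
... | j , heavy = <⇒≱ (light j) heavy

¬ones4≺⇒Light : ∀ {m n} {A : Mat m n} → ¬ (ones4 ≺ A) → Light A
¬ones4≺⇒Light {A = A} no4 with Light⊎heavy A
... | inj₁ light       = light
... | inj₂ (j , heavy) = ⊥-elim (no4 (heavy⇒ones4≺ {A = A} j heavy))

-- The matrix [K_m^3 K_m^2 K_m^1 K_m^0]

∈-allVecs : ∀ m (v : Vec Bool m) → v ∈ allVecs m
∈-allVecs zero    []          = here refl
∈-allVecs (suc m) (true ∷ v)  = ∈-++⁺ˡ (∈-map⁺ (true ∷_) (∈-allVecs m v))
∈-allVecs (suc m) (false ∷ v) = ∈-++⁺ʳ (map (true ∷_) (allVecs m)) (∈-map⁺ (false ∷_) (∈-allVecs m v))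

allVecs-unique : ∀ m → Unique (allVecs m)
allVecs-unique zero    = All.[] ∷ Unique.[]
allVecs-unique (suc m) =
  Unique.++⁺ (Unique.map⁺ ∷-injectiveʳ (allVecs-unique m)) (Unique.map⁺ ∷-injectiveʳ (allVecs-unique m)) disjoint
  where
  disjoint : ∀ {v} → ¬ (v ∈ map (true ∷_) (allVecs m) × v ∈ map (false ∷_) (allVecs m))
  disjoint (v∈₁ , v∈₀) with ∈-map⁻ (true ∷_) v∈₁ | ∈-map⁻ (false ∷_) v∈₀
  ... | _ , _ , refl | _ , _ , ()

length-filter-map : ∀ {A B : Set} {P : B → Set} (P? : Decidable P) (f : A → B) xs →
                    length (filter P? (map f xs)) ≡ length (filter (P? ∘ f) xs)
length-filter-map P? f []       = refl
length-filter-map P? f (x ∷ xs) with does (P? (f x))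
... | true  = cong suc (length-filter-map P? f xs)
... | false = length-filter-map P? f xs

length-filter-allVecs : ∀ m {P : Vec Bool m → Set} (P? : Decidable P) →
                        length (filter P? (allVecs m)) ≡ size (λ v → does (P? v))
length-filter-allVecs zero P? with does (P? [])
... | true  = refl
... | false = refl
length-filter-allVecs (suc m) P? = begin
  length (filter P? (map (true ∷_) vs ++ map (false ∷_) vs))
    ≡⟨ cong length (filter-++ P? (map (true ∷_) vs) _) ⟩
  length (filter P? (map (true ∷_) vs) ++ filter P? (map (false ∷_) vs))
    ≡⟨ length-++ (filter P? (map (true ∷_) vs)) ⟩
  length (filter P? (map (true ∷_) vs)) + length (filter P? (map (false ∷_) vs))
    ≡⟨ cong₂ _+_ (first-entry true) (first-entry false) ⟩
  size (λ v → does (P? v))  ∎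
  where
  open ≡-Reasoning
  vs = allVecs m
  first-entry : ∀ x → length (filter P? (map (x ∷_) vs)) ≡ size (λ u → does (P? (x ∷ u)))
  first-entry x = trans (length-filter-map P? (x ∷_) vs) (length-filter-allVecs m (P? ∘ (x ∷_)))

size-weightBelow-suc : ∀ {m} k → size {m} (weightBelow (suc k)) ≡ size {m} (weightIs k) + size {m} (weightBelow k)
size-weightBelow-suc {zero} zero    = refl
size-weightBelow-suc {zero} (suc k) = refl
size-weightBelow-suc {suc m} zero = begin
  size {m} (weightBelow 0) + size {m} (weightBelow 1)  ≡⟨ cong (_+ size {m} (weightBelow 1)) (size-∅ {m}) ⟩
  size {m} (weightBelow 1)                             ≡⟨ size-weightBelow-suc {m} zero ⟩
  size {m} (weightIs 0) + size {m} (weightBelow 0)     ≡⟨ cong (size {m} (weightIs 0) +_) (size-∅ {m}) ⟩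
  size {m} (weightIs 0) + 0
    ≡⟨ cong₂ (λ a b → a + size {m} (weightIs 0) + (b + b)) (size-∅ {m}) (size-∅ {m}) ⟨
  size {suc m} (weightIs 0) + size {suc m} (weightBelow 0)  ∎
  where open ≡-Reasoning
size-weightBelow-suc {suc m} (suc k) =
  trans (cong₂ _+_ (size-weightBelow-suc {m} k) (size-weightBelow-suc {m} (suc k)))
        (interchange (size {m} (weightIs k)) _ _ _)

Kbelow : (m k : ℕ) → List (Vec Bool m)
Kbelow m zero    = []
Kbelow m (suc k) = Kcols m k ++ Kbelow m k

K3210cols≡Kbelow : ∀ m → K3210cols m ≡ Kbelow m 4
K3210cols≡Kbelow m = cong (λ xs → Kcols m 3 ++ Kcols m 2 ++ Kcols m 1 ++ xs) (sym (++-identityʳ (Kcols m 0)))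

∈-Kcols⁺ : ∀ {m ℓ} {v : Vec Bool m} → weight v ≡ ℓ → v ∈ Kcols m ℓ
∈-Kcols⁺ {m} {ℓ} {v} e = ∈-filter⁺ (λ v → weight v ≟ ℓ) (∈-allVecs m v) e

∈-Kcols⁻ : ∀ {m ℓ} {v : Vec Bool m} → v ∈ Kcols m ℓ → weight v ≡ ℓ
∈-Kcols⁻ {m} {ℓ} v∈ = proj₂ (∈-filter⁻ (λ v → weight v ≟ ℓ) {xs = allVecs m} v∈)

∈-Kbelow⁺ : ∀ {m} k {v : Vec Bool m} → weight v < k → v ∈ Kbelow m k
∈-Kbelow⁺ {m} (suc k) lt with m<1+n⇒m<n∨m≡n lt
... | inj₁ lt′ = ∈-++⁺ʳ (Kcols m k) (∈-Kbelow⁺ k lt′)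
... | inj₂ e   = ∈-++⁺ˡ (∈-Kcols⁺ e)

∈-Kbelow⁻ : ∀ {m} k {v : Vec Bool m} → v ∈ Kbelow m k → weight v < k
∈-Kbelow⁻ {m} (suc k) v∈ with ∈-++⁻ (Kcols m k) v∈
... | inj₁ v∈K = ≤-reflexive (cong suc (∈-Kcols⁻ v∈K))
... | inj₂ v∈B = m<n⇒m<1+n (∈-Kbelow⁻ k v∈B)

Kbelow-unique : ∀ m k → Unique (Kbelow m k)
Kbelow-unique m zero    = Unique.[]
Kbelow-unique m (suc k) =
  Unique.++⁺ (Unique.filter⁺ _ (allVecs-unique m)) (Kbelow-unique m k)
    λ (v∈K , v∈B) → <-irrefl (∈-Kcols⁻ v∈K) (∈-Kbelow⁻ k v∈B)

length-Kbelow : ∀ m k → length (Kbelow m k) ≡ size {m} (weightBelow k)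
length-Kbelow m zero    = sym (size-∅ {m})
length-Kbelow m (suc k) = begin
  length (Kcols m k ++ Kbelow m k)                  ≡⟨ length-++ (Kcols m k) ⟩
  length (Kcols m k) + length (Kbelow m k)
    ≡⟨ cong₂ _+_ (length-filter-allVecs m (λ v → weight v ≟ k)) (length-Kbelow m k) ⟩
  size {m} (weightIs k) + size {m} (weightBelow k)  ≡⟨ size-weightBelow-suc {m} k ⟨
  size {m} (weightBelow (suc k))                    ∎
  where open ≡-Reasoning

Unique⇒lookup-injective : ∀ {A : Set} {xs : List A} → Unique xs → Injective _≡_ _≡_ (List.lookup xs)
Unique⇒lookup-injective {xs = x ∷ xs} (x∉xs ∷ _)    {zero}  {zero}  _ = refl
Unique⇒lookup-injective {xs = x ∷ xs} (x∉xs ∷ _)    {zero}  {suc j} e = ⊥-elim (All.lookup x∉xs (∈-lookup j) e)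
Unique⇒lookup-injective {xs = x ∷ xs} (x∉xs ∷ _)    {suc i} {zero}  e = ⊥-elim (All.lookup x∉xs (∈-lookup i) (sym e))
Unique⇒lookup-injective {xs = x ∷ xs} (_ ∷ unique) {suc i} {suc j} e = cong suc (Unique⇒lookup-injective unique e)

‖K3210‖ : ℕ → ℕ
‖K3210‖ m = length (K3210cols m)

‖K3210‖≡size : ∀ m → ‖K3210‖ m ≡ size {m} (weightBelow 4)
‖K3210‖≡size m = trans (cong length (K3210cols≡Kbelow m)) (length-Kbelow m 4)

K3210-Simple : ∀ m → Simple (K3210 m)
K3210-Simple m = Unique⇒lookup-injective (subst Unique (sym (K3210cols≡Kbelow m)) (Kbelow-unique m 4))

K3210-Light : ∀ m → Light (K3210 m)
K3210-Light m j = ∈-Kbelow⁻ 4 (subst (K3210 m j ∈_) (K3210cols≡Kbelow m) (∈-lookup j))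

∈-K3210cols : ∀ {m} {v : Vec Bool m} → weight v < 4 → v ∈ K3210cols m
∈-K3210cols {m} lt = subst (_ ∈_) (sym (K3210cols≡Kbelow m)) (∈-Kbelow⁺ 4 lt)

module _ {m n} {A : Mat m n} (light : Light A) where

  column∈K3210 : ∀ j → A j ∈ K3210cols m
  column∈K3210 j = ∈-K3210cols (light j)

  toK3210 : Fin n → Fin (‖K3210‖ m)
  toK3210 j = index (column∈K3210 j)

  toK3210-correct : ∀ j → K3210 m (toK3210 j) ≡ A j
  toK3210-correct j = sym (lookup-index (column∈K3210 j))

  toK3210-injective : Simple A → Injective _≡_ _≡_ toK3210
  toK3210-injective simple {i} {j} e =
    simple (trans (sym (toK3210-correct i)) (trans (cong (K3210 m) e) (toK3210-correct j)))

  Light⇒≺K3210 : Simple A → A ≺ K3210 m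
  Light⇒≺K3210 simple =
    (λ i → i) , toK3210 , (λ e → e) , toK3210-injective simple , λ i j → cong (λ v → lookup v i) (toK3210-correct j)

  Light⇒≤‖K3210‖ : Simple A → n ≤ ‖K3210‖ m
  Light⇒≤‖K3210‖ simple = injective⇒≤ (toK3210-injective simple)

injective⇒surjective : ∀ {n k} {f : Fin n → Fin k} → Injective _≡_ _≡_ f → k ≤ n → ∀ y → ∃ λ x → f x ≡ y
injective⇒surjective {n} {suc k} {f} f-inj k≤n y with any? (λ x → f x Data.Fin.≟ y)
... | yes hit = hit
... | no miss = ⊥-elim (<-irrefl refl (≤-trans k≤n (injective⇒≤ {f = squeezed} squeezed-inj)))
  where
  squeezed : Fin n → Fin k
  squeezed x = punchOut {i = y} {j = f x} (λ e → miss (x , sym e))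
  squeezed-inj : Injective _≡_ _≡_ squeezed
  squeezed-inj {x} {x′} e = f-inj (punchOut-injective (λ e → miss (x , sym e)) (λ e → miss (x′ , sym e)) e)

Light⇒≅K3210 : ∀ {m n} {A : Mat m n} → Light A → Simple A → ‖K3210‖ m ≤ n → A ≅ K3210 m
Light⇒≅K3210 {A = A} light simple ‖K‖≤n =
  ↔-id _ , mk↔ₛ′ to (proj₁ ∘ hit) (proj₂ ∘ hit) (λ j → to-inj (proj₂ (hit (to j)))) ,
  λ i j → cong (λ v → lookup v i) (toK3210-correct {A = A} light j)
  where
  to = toK3210 {A = A} light
  to-inj = toK3210-injective {A = A} light simple
  hit = injective⇒surjective to-inj ‖K‖≤n

≺-≅-trans : ∀ {k l m n n′} {F : Mat k l} {A : Mat m n} {B : Mat m n′} → F ≺ A → A ≅ B → F ≺ B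
≺-≅-trans (ρ₁ , σ₁ , ρ₁-inj , σ₁-inj , embeds) (ρ , σ , iso) =
  Inverse.to ρ ∘ ρ₁ , Inverse.to σ ∘ σ₁ ,
  ρ₁-inj ∘ Injection.injective (↔⇒↣ ρ) , σ₁-inj ∘ Injection.injective (↔⇒↣ σ) ,
  λ i j → trans (iso (ρ₁ i) (σ₁ j)) (embeds i j)

≅-Simple : ∀ {m n n′} {A : Mat m n} {B : Mat m n′} → A ≅ B → Simple B → Simple A
≅-Simple {A = A} {B} (ρ , σ , iso) simple {i} {j} Aᵢ≡Aⱼ =
  Injection.injective (↔⇒↣ σ) (simple (lookup-ext λ x → begin
    lookup (B (to σ i)) x                  ≡⟨ cong (lookup (B (to σ i))) (strictlyInverseˡ ρ x) ⟨
    lookup (B (to σ i)) (to ρ (from ρ x))  ≡⟨ iso (from ρ x) i ⟩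
    lookup (A i) (from ρ x)                ≡⟨ cong (λ v → lookup v (from ρ x)) Aᵢ≡Aⱼ ⟩
    lookup (A j) (from ρ x)                ≡⟨ iso (from ρ x) j ⟨
    lookup (B (to σ j)) (to ρ (from ρ x))  ≡⟨ cong (lookup (B (to σ j))) (strictlyInverseˡ ρ x) ⟩
    lookup (B (to σ j)) x                  ∎))
  where
  open ≡-Reasoning
  open Inverse

≅⇒≥ : ∀ {m n n′} {A : Mat m n} {B : Mat m n′} → A ≅ B → n′ ≤ n
≅⇒≥ (_ , σ , _) = injective⇒≤ (Injection.injective (↔⇒↣ (↔-sym σ)))

Avoid-X⇒≤‖K3210‖ : ∀ {m n} {A : Mat m n} → Avoid m X A → n ≤ ‖K3210‖ m
Avoid-X⇒≤‖K3210‖ {m} {A = A} (simple , noX) = begin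
  _                            ≤⟨ size-columnsOf simple ⟩
  size (columnsOf A)           ≤⟨ size-Avoids-X _ (Avoids-X-columnsOf noX) ⟩
  size {m} (weightBelow 4)     ≡⟨ ‖K3210‖≡size m ⟨
  ‖K3210‖ m                    ∎
  where open ≤-Reasoning

Avoid-X-heavy⇒+2≤‖K3210‖ : ∀ {m n} {A : Mat m n} → Avoid m X A → ∀ j → 4 ≤ weight (A j) → n + 2 ≤ ‖K3210‖ m
Avoid-X-heavy⇒+2≤‖K3210‖ {m} {n} {A} (simple , noX) j heavy = begin
  n + 2                        ≤⟨ +-monoˡ-≤ 2 (size-columnsOf simple) ⟩
  size (columnsOf A) + 2       ≤⟨ size-Avoids-X-heavy m _ (Avoids-X-columnsOf noX) (columnsOf-column A j) heavy ⟩
  size {m} (weightBelow 4)     ≡⟨ ‖K3210‖≡size m ⟨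
  ‖K3210‖ m                    ∎
  where open ≤-Reasoning

Avoid-X-large⇒Light : ∀ {m n} {A : Mat m n} → Avoid m X A → ‖K3210‖ m ≤ suc n → Light A
Avoid-X-large⇒Light {n = n} {A} avoid large with Light⊎heavy A
... | inj₁ light       = light
... | inj₂ (j , heavy) =
  ⊥-elim (<-irrefl refl (subst (_≤ suc n) (+-comm n 2) (≤-trans (Avoid-X-heavy⇒+2≤‖K3210‖ avoid j heavy) large)))

Avoid-ones4⇒≤‖K3210‖ : ∀ {m n} {A : Mat m n} → Avoid m ones4 A → n ≤ ‖K3210‖ m
Avoid-ones4⇒≤‖K3210‖ {A = A} (simple , no4) = Light⇒≤‖K3210‖ {A = A} (¬ones4≺⇒Light {A = A} no4) simple

K3210-Avoid-ones4 : ∀ m → Avoid m ones4 (K3210 m)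
K3210-Avoid-ones4 m = K3210-Simple m , Light⇒¬ones4≺ {A = K3210 m} (K3210-Light m)

K3210-Avoid-X : ∀ m → Avoid m X (K3210 m)
K3210-Avoid-X m = K3210-Simple m , Light⇒¬X≺ (K3210-Light m) (K3210-Simple m)

Ext-X⇒Ext-ones4 : ∀ {m n} {A : Mat m n} → Ext m X A → Ext m ones4 A
Ext-X⇒Ext-ones4 {m} {n} {A} (avoid , maximal) =
  (proj₁ avoid , Light⇒¬ones4≺ {A = A} (Avoid-X-large⇒Light avoid (≤-trans ‖K‖≤n (n≤1+n n)))) ,
  λ _ A′ avoid′ → ≤-trans (Avoid-ones4⇒≤‖K3210‖ {A = A′} avoid′) ‖K‖≤n
  where
  ‖K‖≤n = maximal _ (K3210 m) (K3210-Avoid-X m)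

Ext-ones4⇒Ext-X : ∀ {m n} {A : Mat m n} → Ext m ones4 A → Ext m X A
Ext-ones4⇒Ext-X {m} {A = A} ((simple , no4) , maximal) =
  (simple , Light⇒¬X≺ (¬ones4≺⇒Light {A = A} no4) simple) ,
  λ _ _ avoid′ → ≤-trans (Avoid-X⇒≤‖K3210‖ avoid′) (maximal _ (K3210 m) (K3210-Avoid-ones4 m))

Ext-ones4⇒≅K3210 : ∀ {m n} {A : Mat m n} → Ext m ones4 A → A ≅ K3210 m
Ext-ones4⇒≅K3210 {m} {A = A} ((simple , no4) , maximal) =
  Light⇒≅K3210 (¬ones4≺⇒Light {A = A} no4) simple (maximal _ (K3210 m) (K3210-Avoid-ones4 m))

≅K3210⇒Ext-ones4 : ∀ {m n} {A : Mat m n} → A ≅ K3210 m → Ext m ones4 A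
≅K3210⇒Ext-ones4 {m} {A = A} iso =
  (≅-Simple iso (K3210-Simple m) ,
   Light⇒¬ones4≺ {A = K3210 m} (K3210-Light m) ∘ (λ o → ≺-≅-trans {F = ones4} {A = A} {B = K3210 m} o iso)) ,
  λ _ A′ avoid′ → ≤-trans (Avoid-ones4⇒≤‖K3210‖ {A = A′} avoid′) (≅⇒≥ {A = A} {B = K3210 m} iso)

Avoid-X-near-forb⇒≺K3210 : ∀ {m n f} {A : Mat m n} → IsForb m ones4 f → Avoid m X A → f ∸ 1 ≤ n → A ≺ K3210 m
Avoid-X-near-forb⇒≺K3210 {m} {n} {f} {A} (_ , maximal) avoid f-1≤n =
  Light⇒≺K3210 {A = A} (Avoid-X-large⇒Light avoid ‖K‖≤1+n) (proj₁ avoid)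
  where
  ‖K‖≤1+n : ‖K3210‖ m ≤ suc n
  ‖K‖≤1+n = ≤-trans (maximal _ (K3210 m) (K3210-Avoid-ones4 m)) (≤-trans (m≤n+m∸n f 1) (s≤s f-1≤n))

mainTheorem4 : (m : ℕ) →
    (∀ n (A : Mat m n) → Ext m X A ⇔ Ext m ones4 A) ×
    (∀ n (A : Mat m n) → Ext m ones4 A ⇔ A ≅ K3210 m) ×
    (∀ f → IsForb m ones4 f → ∀ n (A : Mat m n) → Avoid m X A → f ∸ 1 ≤ n → A ≺ K3210 m)
mainTheorem4 m =
  (λ n A → mk⇔ Ext-X⇒Ext-ones4 Ext-ones4⇒Ext-X) ,
  (λ n A → mk⇔ Ext-ones4⇒≅K3210 ≅K3210⇒Ext-ones4) ,
  (λ f forb n A → Avoid-X-near-forb⇒≺K3210 forb)
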